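{- Let $k$ be a positive even integer and $r>1$ an integer. Then \[ |W_k(r)|=2^{(r-2)(2k-2)}\,2^{2k-1}\,(2^{k-1}-1). \]
   Context: For a positive integer $n$, $\mathscr{E}_n$ is the directed graph whose vertices are the pairs $(a,b)$ with $a,b\in\{0,\dots,n-1\}$ and $\gcd(a,b,n)=1$, written $a/b$ (integer representatives modulo $n$ may also be used, e.g. $-1/0$ for $(n-1)/0$), with a directed edge $a/b\to c/d$ iff $ad-bc\equiv1\pmod n$. A path of length $m$ is a sequence $\langle v_0,\dots,v_m\rangle$ of vertices with edges $v_{i-1}\to v_i$. $\Omega_{2k}(2)$ is the set of paths $\langle v_0,\dots,v_{2k}\rangle$ of length $2k$ in $\mathscr{E}_2$ with $v_{2i}=1/0$ for $i=0,\dots,k$. A lift to $\mathscr{E}_{2^r}$ of such a path is a path $\langle w_0,\dots,w_{2k}\rangle$ in $\mathscr{E}_{2^r}$ with $w_i$ reducing modulo $2$ to $v_i$ for every $i$. $W_k(r)$ is the set of lifts to $\mathscr{E}_{2^r}$ of paths in $\Omega_{2k}(2)$ that have initial vertex $1/0$ and final vertex $-1/0$. -}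

module Defs where

open import Data.Nat using (ℕ; zero; suc; _+_; _*_; _∸_; _^_; _<_; NonZero)
open import Data.Nat.Properties using (m^n≢0)
open import Data.Nat.GCD using (gcd)
open import Data.Bool using (Bool; true; false; not)
open import Data.Product using (_×_; _,_; Σ)
open import Data.Unit using (⊤)
open import Data.List using (List; []; _∷_; map; head; last)
open import Data.Maybe using (Maybe; just)
open import Data.Fin using (Fin; toℕ)
open import Data.Vec using (Vec; toList)
open import Relation.Binary.PropositionalEquality using (_≡_)

-- A candidate vertex a/b of 𝓔ₙ, written with natural-number representatives.
Pair : Set
Pair = ℕ × ℕ

IsVertex : (n : ℕ) → Pair → Set
IsVertex n (a , b) = (a < n) × (b < n) × (gcd (gcd a b) n ≡ 1)

-- directed edge a/b → c/d in 𝓔ₙ :  ad − bc ≡ 1 (mod n),  i.e.  ad ≡ bc + 1 (mod n)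
IsEdge : (n : ℕ) .{{_ : NonZero n}} → Pair → Pair → Set
IsEdge n (a , b) (c , d) = (a * d) Data.Nat.% n ≡ (b * c + 1) Data.Nat.% n

IsPath : (n : ℕ) .{{_ : NonZero n}} → List Pair → Set
IsPath n []           = ⊤
IsPath n (v ∷ [])     = IsVertex n v
IsPath n (v ∷ w ∷ vs) = IsVertex n v × IsEdge n v w × IsPath n (w ∷ vs)

EvenAt : Pair → Bool → List Pair → Set
EvenAt u _     []       = ⊤
EvenAt u true  (v ∷ vs) = (v ≡ u) × EvenAt u false vs
EvenAt u false (v ∷ vs) = EvenAt u true vs

InΩ : (k : ℕ) → Vec Pair (suc (2 * k)) → Set
InΩ k v = IsPath 2 (toList v) × EvenAt (1 , 0) true (toList v)

reduce₂ : {N : ℕ} → Fin N × Fin N → Pair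
reduce₂ (a , b) = (toℕ a Data.Nat.% 2 , toℕ b Data.Nat.% 2)

asPair : {N : ℕ} → Fin N × Fin N → Pair
asPair (a , b) = (toℕ a , toℕ b)


IsW : (k r : ℕ) → Vec (Fin (2 ^ r) × Fin (2 ^ r)) (suc (2 * k)) → Set
IsW k r w =
  IsPath (2 ^ r) {{m^n≢0 2 r}} (map asPair (toList w))
  × InΩ k (Data.Vec.map reduce₂ w)
  × (head (map asPair (toList w)) ≡ just (1 , 0))
  × (last (map asPair (toList w)) ≡ just (2 ^ r ∸ 1 , 0))

W : (k r : ℕ) → Set
W k r = Σ (Vec (Fin (2 ^ r) × Fin (2 ^ r)) (suc (2 * k))) (IsW k r)

{-# OPTIONS --safe #-}
module Submission where

-- Write N = 2^r, M = N/2, L = N/4, k = n + 1, and num, den for the two coordinates of a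
-- vertex. A lift starts 1/0, c/1 with c free, as det(1/0, w₁) = den w₁. After a vertex q with
-- den q odd, the next two vertices x, y correspond to a block (t, β) ∈ ℤ/N × ℤ/M: den x = 2β
-- determines x because den q is a unit, and Cramer's rule gives y = t·x − q with t = det(q, y).
-- The final vertex −1/0 only requires den ≡ 1 at the last odd vertex, and these dens evolve by
-- σ ↦ 2tβ − σ; for odd n the condition becomes Σⱼ (−1)ʲ tⱼβⱼ ≡ 1 (mod M). Splitting on the
-- parity of the first β, such block sequences number g(n) with g(n + 1) = L·N·g(n) + 2L·(N·M)ⁿ,
-- so |W_k(r)| = N·g(n), and solving the recursion gives the formula.

module Lifts where

  open import Defs
  open import Data.Nat as ℕ using (ℕ; zero; suc; NonZero; _<_; _^_; _∸_)
  import Data.Nat.Properties as ℕ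
  import Data.Nat.Divisibility as ℕ
  open import Data.Nat.DivMod using (m%n<n)
  open import Data.Nat.GCD using (gcd; gcd[m,n]∣m; gcd[m,n]∣n)
  import Data.Nat.Tactic.RingSolver as ℕ-Solver
  open import Data.Integer as ℤ using (ℤ; +_; _⊖_; _+_; _*_; -_; _-_; _%ℕ_; _/ℕ_)
  import Data.Integer.Properties as ℤ
  open import Data.Integer.DivMod using (n%ℕd<d; a≡a%ℕn+[a/ℕn]*n)
  open import Data.Integer.Divisibility.Signed as ℤ∣ using (divides) renaming (_∣_ to _∣ℤ_)
  open import Data.Integer.Tactic.RingSolver using (solve-∀)
  open import Data.Fin as Fin using (Fin; toℕ; fromℕ<)
  import Data.Fin.Properties as Fin
  open import Data.Vec as Vec using (Vec; []; _∷_; toList)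
  import Data.Vec.Properties as Vec
  import Data.Vec.Recursive as Vecᵣ
  import Data.Vec.Recursive.Properties as Vecᵣ
  open import Data.List using (List; []; _∷_; map; head; last)
  open import Data.Maybe using (Maybe; just)
  import Data.Maybe.Properties as Maybe
  open import Data.Bool using (Bool; true; false)
  open import Data.Unit using (⊤; tt)
  open import Data.Empty using (⊥-elim)
  open import Data.Product using (Σ; _×_; _,_; proj₁; proj₂; uncurry)
  import Data.Product.Properties as ×
  open import Data.Product.Function.Dependent.Propositional using (Σ-↔)
  open import Data.Product.Function.NonDependent.Propositional using (_×-↔_)
  open import Data.Sum using (_⊎_; inj₁; inj₂)
  open import Data.Sum.Function.Propositional using (_⊎-↔_)
  open import Function.Base using (_∘_)
  open import Function.Bundles using (_⇔_; mk⇔; Equivalence; _↔_; mk↔ₛ′; Inverse)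
  open import Function.Properties.Inverse using (↔-refl; ↔-sym; ↔-trans)
  open import Function.Related.Propositional using (module EquationalReasoning)
  open import Function.Related.TypeIsomorphisms using (∃∃↔∃∃)
  open import Level using (0ℓ)
  open import Relation.Binary.Bundles using (Setoid)
  open import Relation.Binary.PropositionalEquality
  open import Relation.Nullary using (¬_; Irrelevant; contradiction)
  import Axiom.UniquenessOfIdentityProofs as UIP

  ×-irrelevant : ∀ {A B : Set} → Irrelevant A → Irrelevant B → Irrelevant (A × B)
  ×-irrelevant irrA irrB (a , b) (a′ , b′) = cong₂ _,_ (irrA a a′) (irrB b b′)

  Σ-≡-irrelevant : ∀ {A : Set} {P : A → Set} → (∀ {a} → Irrelevant (P a)) →
                   ∀ {x y : Σ A P} → proj₁ x ≡ proj₁ y → x ≡ y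
  Σ-≡-irrelevant irr {a , p} {.a , q} refl = cong (a ,_) (irr p q)

  ⇔⇒↔ : ∀ {A B : Set} → Irrelevant A → Irrelevant B → A ⇔ B → A ↔ B
  ⇔⇒↔ irrA irrB A⇔B = mk↔ₛ′ (Equivalence.to A⇔B) (Equivalence.from A⇔B) (λ _ → irrB _ _) (λ _ → irrA _ _)

  Σ-Fin2-↔ : ∀ {P : Fin 2 → Set} → Σ (Fin 2) P ↔ (P Fin.zero ⊎ P (Fin.suc Fin.zero))
  Σ-Fin2-↔ = mk↔ₛ′ (λ { (Fin.zero , p) → inj₁ p ; (Fin.suc Fin.zero , p) → inj₂ p })
                   (λ { (inj₁ p) → Fin.zero , p ; (inj₂ p) → Fin.suc Fin.zero , p })
                   (λ { (inj₁ p) → refl ; (inj₂ p) → refl })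
                   (λ { (Fin.zero , p) → refl ; (Fin.suc Fin.zero , p) → refl })

  Σ-assoc₄ : ∀ {A B C D : Set} {P : A × B × C × D → Set} →
             Σ (A × B × C × D) P ↔ (Σ A λ a → Σ B λ b → Σ C λ c → Σ D λ d → P (a , b , c , d))
  Σ-assoc₄ = mk↔ₛ′ (λ ((a , b , c , d) , p) → a , b , c , d , p) (λ (a , b , c , d , p) → (a , b , c , d) , p)
                   (λ _ → refl) (λ _ → refl)

  ∷-Σ-↔ : ∀ {A : Set} {m} {P : Vec A (suc m) → Set} →
          (Σ A λ a → Σ (Vec A m) λ as → P (a ∷ as)) ↔ Σ (Vec A (suc m)) P
  ∷-Σ-↔ = mk↔ₛ′ (λ (a , as , p) → a ∷ as , p) (λ { (a ∷ as , p) → a , as , p })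
                (λ { (a ∷ as , p) → refl }) (λ { (a , as , p) → refl })

  Vec-cast-↔ : ∀ {A : Set} {m n} → m ≡ n → Vec A m ↔ Vec A n
  Vec-cast-↔ eq = mk↔ₛ′ (Vec.cast eq) (Vec.cast (sym eq))
    (λ xs → trans (Vec.cast-trans (sym eq) eq xs) (Vec.cast-is-id refl xs))
    (λ xs → trans (Vec.cast-trans eq (sym eq) xs) (Vec.cast-is-id refl xs))

  Vec-↔-Fin^ : ∀ {A : Set} {a} n → A ↔ Fin a → Vec A n ↔ Fin (a ^ n)
  Vec-↔-Fin^ {a = a} n A↔Fin =
    ↔-trans (↔-sym (Vecᵣ.↔Vec n)) (↔-trans (Vecᵣ.lift↔ n A↔Fin) (↔-sym (Vecᵣ.Fin[m^n]↔Fin[m]^n a n)))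

  Fin-*³-↔ : ∀ {a b c} → Fin (a ℕ.* (b ℕ.* c)) ↔ (Fin a × Fin b × Fin c)
  Fin-*³-↔ = ↔-trans Fin.*↔× (↔-refl ×-↔ Fin.*↔×)

  -- Congruences of integers

  -- a record rather than a synonym for divisibility, so that x, y and n can be inferred
  infix 4 _≡_mod_
  record _≡_mod_ (x y : ℤ) (n : ℕ) : Set where
    constructor mk≡mod
    field n∣x-y : + n ∣ℤ x - y

  module _ {n : ℕ} where

    ∣⇒≡-mod : ∀ {x y z} → z ≡ x - y → + n ∣ℤ z → x ≡ y mod n
    ∣⇒≡-mod refl n∣z = mk≡mod n∣z

    ≡-mod-reflexive : ∀ {x y} → x ≡ y → x ≡ y mod n
    ≡-mod-reflexive {x} refl = mk≡mod (divides (+ 0) (ℤ.+-inverseʳ x))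

    ≡-mod-refl : ∀ {x} → x ≡ x mod n
    ≡-mod-refl = ≡-mod-reflexive refl

    ≡-mod-sym : ∀ {x y} → x ≡ y mod n → y ≡ x mod n
    ≡-mod-sym {x} {y} (mk≡mod n∣x-y) = ∣⇒≡-mod (identity x y) (ℤ∣.∣m⇒∣-m n∣x-y)
      where
      identity : ∀ x y → - (x - y) ≡ y - x
      identity = solve-∀

    ≡-mod-trans : ∀ {x y z} → x ≡ y mod n → y ≡ z mod n → x ≡ z mod n
    ≡-mod-trans {x} {y} {z} (mk≡mod n∣x-y) (mk≡mod n∣y-z) = ∣⇒≡-mod (identity x y z) (ℤ∣.∣m∣n⇒∣m+n n∣x-y n∣y-z)
      where
      identity : ∀ x y z → (x - y) + (y - z) ≡ x - z
      identity = solve-∀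

    +-cong-mod : ∀ {x y u v} → x ≡ y mod n → u ≡ v mod n → x + u ≡ y + v mod n
    +-cong-mod {x} {y} {u} {v} (mk≡mod n∣x-y) (mk≡mod n∣u-v) =
      ∣⇒≡-mod (identity x y u v) (ℤ∣.∣m∣n⇒∣m+n n∣x-y n∣u-v)
      where
      identity : ∀ x y u v → (x - y) + (u - v) ≡ (x + u) - (y + v)
      identity = solve-∀

    *-cong-mod : ∀ {x y u v} → x ≡ y mod n → u ≡ v mod n → x * u ≡ y * v mod n
    *-cong-mod {x} {y} {u} {v} (mk≡mod n∣x-y) (mk≡mod n∣u-v) =
      ∣⇒≡-mod (identity x y u v) (ℤ∣.∣m∣n⇒∣m+n (ℤ∣.∣n⇒∣m*n x n∣u-v) (ℤ∣.∣m⇒∣m*n v n∣x-y))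
      where
      identity : ∀ x y u v → x * (u - v) + (x - y) * v ≡ x * u - y * v
      identity = solve-∀

    neg-cong-mod : ∀ {x y} → x ≡ y mod n → - x ≡ - y mod n
    neg-cong-mod {x} {y} (mk≡mod n∣x-y) = ∣⇒≡-mod (identity x y) (ℤ∣.∣m⇒∣-m n∣x-y)
      where
      identity : ∀ x y → - (x - y) ≡ - x - - y
      identity = solve-∀

    -‿cong-mod : ∀ {x y u v} → x ≡ y mod n → u ≡ v mod n → x - u ≡ y - v mod n
    -‿cong-mod p q = +-cong-mod p (neg-cong-mod q)

    multiple≡0-mod : ∀ q → q * + n ≡ + 0 mod n
    multiple≡0-mod q = ∣⇒≡-mod (sym (ℤ.+-identityʳ (q * + n))) (divides q refl)

  ≡-mod-setoid : ℕ → Setoid 0ℓ 0ℓ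
  ≡-mod-setoid n = record
    { Carrier = ℤ
    ; _≈_ = λ x y → x ≡ y mod n
    ; isEquivalence = record { refl = ≡-mod-refl ; sym = ≡-mod-sym ; trans = ≡-mod-trans }
    }

  module ≡-mod-Reasoning (n : ℕ) where
    open import Relation.Binary.Reasoning.Setoid (≡-mod-setoid n) public

  ≡-mod-1 : ∀ x y → x ≡ y mod 1
  ≡-mod-1 x y = mk≡mod (divides (x - y) (sym (ℤ.*-identityʳ (x - y))))

  ≡-mod-∣ : ∀ {d n x y} → d ℕ.∣ n → x ≡ y mod n → x ≡ y mod d
  ≡-mod-∣ d∣n (mk≡mod n∣x-y) = mk≡mod (ℤ∣.∣-trans (ℤ∣.∣ᵤ⇒∣ d∣n) n∣x-y)

  *-cong-mod-scale : ∀ k {n x y} → x ≡ y mod n → + k * x ≡ + k * y mod k ℕ.* n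
  *-cong-mod-scale k {n} {x} {y} (mk≡mod n∣x-y) =
    mk≡mod (subst₂ _∣ℤ_ (sym (ℤ.pos-* k n)) (identity (+ k) x y) (ℤ∣.*-monoʳ-∣ (+ k) n∣x-y))
    where
    identity : ∀ k x y → k * (x - y) ≡ k * x - k * y
    identity = solve-∀

  *-cancel-mod-scale : ∀ k .{{_ : NonZero k}} {n x y} → + k * x ≡ + k * y mod k ℕ.* n → x ≡ y mod n
  *-cancel-mod-scale k {n} {x} {y} (mk≡mod kn∣kx-ky) =
    mk≡mod (ℤ∣.*-cancelˡ-∣ (+ k) (subst₂ _∣ℤ_ (ℤ.pos-* k n) (sym (identity (+ k) x y)) kn∣kx-ky))
    where
    identity : ∀ k x y → k * (x - y) ≡ k * x - k * y
    identity = solve-∀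

  ≡-mod-irrelevant : ∀ {n x y} .{{_ : NonZero n}} → Irrelevant (x ≡ y mod n)
  ≡-mod-irrelevant {n} (mk≡mod (divides q eq)) (mk≡mod (divides q′ eq′))
    with ℤ.*-cancelʳ-≡ q q′ (+ n) (trans (sym eq) eq′)
  ... | refl = cong (mk≡mod ∘ divides q) (UIP.Decidable⇒UIP.≡-irrelevant ℤ._≟_ eq eq′)

  module _ {n : ℕ} .{{_ : NonZero n}} where

    ≡-mod-↔ : ∀ {x x′ y y′} → x ≡ x′ mod n → y ≡ y′ mod n → (x ≡ y mod n) ↔ (x′ ≡ y′ mod n)
    ≡-mod-↔ x≡x′ y≡y′ = ⇔⇒↔ ≡-mod-irrelevant ≡-mod-irrelevant (mk⇔
      (λ x≡y → ≡-mod-trans (≡-mod-sym x≡x′) (≡-mod-trans x≡y y≡y′))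
      (λ x′≡y′ → ≡-mod-trans x≡x′ (≡-mod-trans x′≡y′ (≡-mod-sym y≡y′))))

    a-l≡w↔l≡a-w : ∀ {a l w} → (a - l ≡ w mod n) ↔ (l ≡ a - w mod n)
    a-l≡w↔l≡a-w {a} {l} {w} = ⇔⇒↔ ≡-mod-irrelevant ≡-mod-irrelevant (mk⇔
      (λ a-l≡w → ≡-mod-trans (≡-mod-reflexive (identity₁ a l)) (-‿cong-mod (≡-mod-refl {x = a}) a-l≡w))
      (λ l≡a-w → ≡-mod-trans (-‿cong-mod (≡-mod-refl {x = a}) l≡a-w) (≡-mod-reflexive (identity₂ a w))))
      where
      identity₁ : ∀ a l → l ≡ a - (a - l)
      identity₁ = solve-∀
      identity₂ : ∀ a w → a - (a - w) ≡ w
      identity₂ = solve-∀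

    a-l≡w↔a≡w+l : ∀ {a l w} → (a - l ≡ w mod n) ↔ (a ≡ w + l mod n)
    a-l≡w↔a≡w+l {a} {l} {w} = ⇔⇒↔ ≡-mod-irrelevant ≡-mod-irrelevant (mk⇔
      (λ a-l≡w → ≡-mod-trans (≡-mod-reflexive (identity₁ a l)) (+-cong-mod a-l≡w (≡-mod-refl {x = l})))
      (λ a≡w+l → ≡-mod-trans (-‿cong-mod a≡w+l (≡-mod-refl {x = l})) (≡-mod-reflexive (identity₂ w l))))
      where
      identity₁ : ∀ a l → a ≡ a - l + l
      identity₁ = solve-∀
      identity₂ : ∀ w l → w + l - l ≡ w
      identity₂ = solve-∀

  toℤ : ∀ {n} → Fin n → ℤ
  toℤ i = + toℕ i

  module _ {n : ℕ} .{{_ : NonZero n}} where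

    residue : ℤ → Fin n
    residue x = fromℕ< (n%ℕd<d x n)

    toℕ-residue : ∀ x → toℕ (residue x) ≡ x %ℕ n
    toℕ-residue x = Fin.toℕ-fromℕ< (n%ℕd<d x n)

    %ℕ≡-mod : ∀ x → + (x %ℕ n) ≡ x mod n
    %ℕ≡-mod x = ≡-mod-sym (∣⇒≡-mod quotient-eq (divides (x /ℕ n) refl))
      where
      identity : ∀ r q m → q * m ≡ (r + q * m) - r
      identity = solve-∀
      quotient-eq : x /ℕ n * + n ≡ x - + (x %ℕ n)
      quotient-eq = trans (identity (+ (x %ℕ n)) (x /ℕ n) (+ n))
                          (cong (_- + (x %ℕ n)) (sym (a≡a%ℕn+[a/ℕn]*n x n)))

    toℤ-residue : ∀ x → toℤ (residue x) ≡ x mod n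
    toℤ-residue x = subst (_≡ x mod n) (cong +_ (sym (toℕ-residue x))) (%ℕ≡-mod x)

    private
      ∣⊖∣<n : ∀ {a b} → a < n → b < n → ℤ.∣ a ⊖ b ∣ < n
      ∣⊖∣<n {a} {b} a<n b<n with ℕ.≤-total a b
      ... | inj₁ a≤b = ℕ.≤-<-trans (ℕ.≤-reflexive (ℤ.∣⊖∣-≤ a≤b)) (ℕ.≤-<-trans (ℕ.m∸n≤m b a) b<n)
      ... | inj₂ b≤a = ℕ.≤-<-trans (ℕ.≤-reflexive (trans (ℤ.∣m⊖n∣≡∣n⊖m∣ a b) (ℤ.∣⊖∣-≤ b≤a)))
                                   (ℕ.≤-<-trans (ℕ.m∸n≤m a b) a<n)

    toℤ-injective-mod : ∀ {i j : Fin n} → toℤ i ≡ toℤ j mod n → i ≡ j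
    toℤ-injective-mod {i} {j} (mk≡mod n∣i-j) =
      Fin.toℕ-injective (ℤ.+-injective (ℤ.i-j≡0⇒i≡j _ _ (ℤ.∣i∣≡0⇒i≡0 distance≡0)))
      where
      n∣distance : n ℕ.∣ ℤ.∣ toℤ i - toℤ j ∣
      n∣distance = ℤ∣.∣⇒∣ᵤ n∣i-j
      distance<n : ℤ.∣ toℤ i - toℤ j ∣ < n
      distance<n = subst (_< n) (cong ℤ.∣_∣ (sym (ℤ.m-n≡m⊖n (toℕ i) (toℕ j))))
                         (∣⊖∣<n (Fin.toℕ<n i) (Fin.toℕ<n j))
      distance≡0 : ℤ.∣ toℤ i - toℤ j ∣ ≡ 0
      distance≡0 with ℤ.∣ toℤ i - toℤ j ∣ | n∣distance | distance<n
      ... | zero  | _   | _   = refl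
      ... | suc _ | n∣d | d<n = contradiction n∣d (ℕ.>⇒∤ d<n)

    residue-unique : ∀ {x} (i : Fin n) → toℤ i ≡ x mod n → residue x ≡ i
    residue-unique {x} i i≡x = toℤ-injective-mod (≡-mod-trans (toℤ-residue x) (≡-mod-sym i≡x))

    residue-cong : ∀ {x y} → x ≡ y mod n → residue x ≡ residue y
    residue-cong {x} {y} x≡y = residue-unique (residue y) (≡-mod-trans (toℤ-residue y) (≡-mod-sym x≡y))

    %≡%⇔≡-mod : ∀ a b → (a ℕ.% n ≡ b ℕ.% n) ⇔ (+ a ≡ + b mod n)
    %≡%⇔≡-mod a b = mk⇔
      (λ eq → ≡-mod-trans (≡-mod-sym (%ℕ≡-mod (+ a))) (subst (λ r → + r ≡ + b mod n) (sym eq) (%ℕ≡-mod (+ b))))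
      (λ a≡b → trans (sym (toℕ-residue (+ a))) (trans (cong toℕ (residue-cong a≡b)) (toℕ-residue (+ b))))

    toℤ-combine-mod : ∀ {d} (i : Fin d) (j : Fin n) → toℤ (Fin.combine i j) ≡ toℤ j mod n
    toℤ-combine-mod i j = ∣⇒≡-mod (begin
      toℤ i * + n                         ≡⟨ identity (toℤ i) (+ n) (toℤ j) ⟩
      (+ n * toℤ i + toℤ j) - toℤ j       ≡⟨ cong (λ z → z + toℤ j - toℤ j) (ℤ.pos-* n (toℕ i)) ⟨
      (+ (n ℕ.* toℕ i) + toℤ j) - toℤ j   ≡⟨ cong (_- toℤ j) (ℤ.pos-+ (n ℕ.* toℕ i) (toℕ j)) ⟨
      + (n ℕ.* toℕ i ℕ.+ toℕ j) - toℤ j   ≡⟨ cong (λ z → + z - toℤ j) (Fin.toℕ-combine i j) ⟨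
      toℤ (Fin.combine i j) - toℤ j       ∎) (divides (toℤ i) refl)
      where
      open ≡-Reasoning
      identity : ∀ i n j → i * n ≡ (n * i + j) - j
      identity = solve-∀

    toℤ-remQuot-mod : ∀ {d} (t : Fin (d ℕ.* n)) → toℤ t ≡ toℤ (proj₂ (Fin.remQuot {d} n t)) mod n
    toℤ-remQuot-mod {d} t = subst (λ z → toℤ z ≡ toℤ (proj₂ (Fin.remQuot {d} n t)) mod n)
      (Fin.combine-remQuot {d} n t) (toℤ-combine-mod (proj₁ (Fin.remQuot {d} n t)) (proj₂ (Fin.remQuot {d} n t)))

    -- the solutions are the t ≡ c·v (mod n), one for each value of the high digit t div n
    unit-congruence-↔ : ∀ d {u v c} → u * v ≡ + 1 mod n →
                        Σ (Fin (d ℕ.* n)) (λ t → toℤ t * u ≡ c mod n) ↔ Fin d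
    unit-congruence-↔ d {u} {v} {c} uv≡1 = mk↔ₛ′ (proj₁ ∘ Fin.remQuot {d} n ∘ proj₁) solution
      (λ i → cong proj₁ (Fin.remQuot-combine {d} i r))
      (λ (t , tu≡c) → Σ-≡-irrelevant ≡-mod-irrelevant
        (trans (cong (Fin.combine {d} (proj₁ (Fin.remQuot {d} n t))) (residue-unique _ (low-digit t tu≡c)))
               (Fin.combine-remQuot {d} n t)))
      where
      open ≡-mod-Reasoning n
      r : Fin n
      r = residue (c * v)
      identity₁ : ∀ c v u → c * v * u ≡ c * (u * v)
      identity₁ = solve-∀
      identity₂ : ∀ t u v → t * (u * v) ≡ t * u * v
      identity₂ = solve-∀
      solution : Fin d → Σ (Fin (d ℕ.* n)) (λ t → toℤ t * u ≡ c mod n)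
      solution i = Fin.combine i r , (begin
        toℤ (Fin.combine i r) * u ≈⟨ *-cong-mod (≡-mod-trans (toℤ-combine-mod i r) (toℤ-residue (c * v)))
                                                (≡-mod-refl {x = u}) ⟩
        c * v * u                 ≡⟨ identity₁ c v u ⟩
        c * (u * v)               ≈⟨ *-cong-mod (≡-mod-refl {x = c}) uv≡1 ⟩
        c * + 1                   ≡⟨ ℤ.*-identityʳ c ⟩
        c                         ∎)
      low-digit : ∀ (t : Fin (d ℕ.* n)) → toℤ t * u ≡ c mod n → toℤ (proj₂ (Fin.remQuot {d} n t)) ≡ c * v mod n
      low-digit t tu≡c = begin
        toℤ (proj₂ (Fin.remQuot {d} n t)) ≈⟨ toℤ-remQuot-mod {d} t ⟨
        toℤ t                             ≡⟨ ℤ.*-identityʳ (toℤ t) ⟨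
        toℤ t * + 1                       ≈⟨ *-cong-mod (≡-mod-refl {x = toℤ t}) uv≡1 ⟨
        toℤ t * (u * v)                   ≡⟨ identity₂ (toℤ t) u v ⟩
        toℤ t * u * v                     ≈⟨ *-cong-mod tu≡c (≡-mod-refl {x = v}) ⟩
        c * v                             ∎

  parity-↔ : ∀ m → Fin (2 ℕ.* m) ↔ (Fin m × Fin 2)
  parity-↔ m = mk↔ₛ′ (Fin.remQuot 2 ∘ Fin.cast (ℕ.*-comm 2 m)) (Fin.cast (ℕ.*-comm m 2) ∘ uncurry Fin.combine)
    (λ (h , b) → trans (cong (Fin.remQuot 2) (Fin.cast-involutive (ℕ.*-comm 2 m) (ℕ.*-comm m 2) _))
                       (Fin.remQuot-combine h b))
    (λ i → trans (cong (Fin.cast (ℕ.*-comm m 2)) (Fin.combine-remQuot {m} 2 _))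
                 (Fin.cast-involutive (ℕ.*-comm m 2) (ℕ.*-comm 2 m) i))

  toℤ-from-parity-↔ : ∀ m (h : Fin m) (b : Fin 2) → toℤ (Inverse.from (parity-↔ m) (h , b)) ≡ + 2 * toℤ h + toℤ b
  toℤ-from-parity-↔ m h b = begin
    + toℕ (Fin.cast _ (Fin.combine h b)) ≡⟨ cong +_ (trans (Fin.toℕ-cast _ _) (Fin.toℕ-combine h b)) ⟩
    + (2 ℕ.* toℕ h ℕ.+ toℕ b)           ≡⟨ ℤ.pos-+ (2 ℕ.* toℕ h) (toℕ b) ⟩
    + (2 ℕ.* toℕ h) + toℤ b              ≡⟨ cong (_+ toℤ b) (ℤ.pos-* 2 (toℕ h)) ⟩
    + 2 * toℤ h + toℤ b                  ∎
    where open ≡-Reasoning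

  toℤ-to-parity-↔ : ∀ m (i : Fin (2 ℕ.* m)) → let (h , b) = Inverse.to (parity-↔ m) i in toℤ i ≡ + 2 * toℤ h + toℤ b
  toℤ-to-parity-↔ m i = trans (cong toℤ (sym (Inverse.strictlyInverseʳ (parity-↔ m) i))) (toℤ-from-parity-↔ m _ _)

  0≢1-mod-2 : ¬ (+ 0 ≡ + 1 mod 2)
  0≢1-mod-2 0≡1 with toℤ-injective-mod {i = Fin.zero} {j = Fin.suc Fin.zero} 0≡1
  ... | ()

  odd-*ʳ : ∀ x {y} → x * y ≡ + 1 mod 2 → y ≡ + 1 mod 2
  odd-*ʳ x {y} xy≡1 with residue {2} y | toℤ-residue {2} y
  ... | Fin.suc Fin.zero | 1≡y = ≡-mod-sym 1≡y
  ... | Fin.zero         | 0≡y = contradiction (begin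
    + 0         ≡⟨ ℤ.*-zeroʳ x ⟨
    x * + 0     ≈⟨ *-cong-mod (≡-mod-refl {x = x}) 0≡y ⟩
    x * y       ≈⟨ xy≡1 ⟩
    + 1         ∎) 0≢1-mod-2
    where open ≡-mod-Reasoning 2

  2*x-even : ∀ x → + 2 * x ≡ + 0 mod 2
  2*x-even x = ∣⇒≡-mod (identity x) (divides x refl)
    where
    identity : ∀ x → x * + 2 ≡ + 2 * x - + 0
    identity = solve-∀

  2*x+1-odd : ∀ x → + 2 * x + + 1 ≡ + 1 mod 2
  2*x+1-odd x = ∣⇒≡-mod (identity x) (divides x refl)
    where
    identity : ∀ x → x * + 2 ≡ + 2 * x + + 1 - + 1
    identity = solve-∀

  even-minus-odd : ∀ x {w} → w ≡ + 1 mod 2 → x * + 2 - w ≡ + 1 mod 2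
  even-minus-odd x w≡1 = ≡-mod-trans (-‿cong-mod (multiple≡0-mod x) w≡1) (mk≡mod (divides (- + 1) refl))

  -1^-odd : ∀ n → 2 ℕ.∣ suc n → (- + 1) ℤ.^ n ≡ - + 1
  -1^-odd n (ℕ.divides q 1+n≡q*2) = trans (sym (ℤ.neg-involutive _)) (cong -_ (begin
    - ((- + 1) ℤ.^ n)        ≡⟨ ℤ.-1*i≡-i _ ⟨
    (- + 1) ℤ.^ suc n        ≡⟨ cong ((- + 1) ℤ.^_) (trans 1+n≡q*2 (ℕ.*-comm q 2)) ⟩
    (- + 1) ℤ.^ (2 ℕ.* q)    ≡⟨ ℤ.^-*-assoc (- + 1) 2 q ⟨
    (+ 1) ℤ.^ q              ≡⟨ ℤ.^-zeroˡ q ⟩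
    + 1                      ∎))
    where open ≡-Reasoning

  -- partial sums of the geometric series in 1 - x: as x = 1 - (1 - x), they invert an odd x
  odd-inverse : ℕ → ℤ → ℤ
  odd-inverse zero    x = + 0
  odd-inverse (suc e) x = + 1 + (+ 1 - x) * odd-inverse e x

  *-odd-inverse : ∀ e {x} → x ≡ + 1 mod 2 → x * odd-inverse e x ≡ + 1 mod 2 ^ e
  *-odd-inverse zero    _ = ≡-mod-1 _ _
  *-odd-inverse (suc e) {x} x≡1@(mk≡mod (divides q x-1≡q*2))
    with *-odd-inverse e x≡1
  ... | mk≡mod (divides q′ xy-1≡q′*2^e) = mk≡mod (divides (- q * q′) (begin
    x * (+ 1 + (+ 1 - x) * y) - + 1   ≡⟨ identity₁ x y ⟩
    - ((x - + 1) * (x * y - + 1))      ≡⟨ cong₂ (λ a b → - (a * b)) x-1≡q*2 xy-1≡q′*2^e ⟩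
    - ((q * + 2) * (q′ * + (2 ^ e)))   ≡⟨ identity₂ q q′ (+ (2 ^ e)) ⟩
    (- q * q′) * (+ 2 * + (2 ^ e))     ≡⟨ cong ((- q * q′) *_) (ℤ.pos-* 2 (2 ^ e)) ⟨
    (- q * q′) * + (2 ^ suc e)         ∎))
    where
    open ≡-Reasoning
    y = odd-inverse e x
    identity₁ : ∀ x y → x * (+ 1 + (+ 1 - x) * y) - + 1 ≡ - ((x - + 1) * (x * y - + 1))
    identity₁ = solve-∀
    identity₂ : ∀ q q′ p → - ((q * + 2) * (q′ * p)) ≡ (- q * q′) * (+ 2 * p)
    identity₂ = solve-∀

  -- Counting solutions of Σⱼ (−1)ʲ tⱼ βⱼ ≡ w (mod M)

  module Counting (s d : ℕ) where

    L M T : ℕ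
    L = 2 ^ s
    M = 2 ℕ.* L
    T = d ℕ.* M

    instance
      L≢0 : NonZero L
      L≢0 = ℕ.m^n≢0 2 s
      M≢0 : NonZero M
      M≢0 = ℕ.m*n≢0 2 L

    Block : Set
    Block = Fin T × Fin M

    alternating-sum : ∀ {n} → Vec Block n → ℤ
    alternating-sum []            = + 0
    alternating-sum ((t , β) ∷ ps) = toℤ t * toℤ β - alternating-sum ps

    Solutions : ℕ → ℤ → Set
    Solutions n w = Σ (Vec Block n) (λ ps → alternating-sum ps ≡ w mod M)

    solution-count : ℕ → ℕ
    solution-count zero    = 0
    solution-count (suc n) = L ℕ.* (T ℕ.* solution-count n) ℕ.+ L ℕ.* ((T ℕ.* M) ^ n ℕ.* d)

    first-block-↔ : ∀ n → Vec Block (suc n) ↔ (Fin 2 × Fin L × Vec Block n × Fin T)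
    first-block-↔ n = mk↔ₛ′
      (λ { ((t , β) ∷ ps) → let (h , b) = Inverse.to (parity-↔ L) β in b , h , ps , t })
      (λ (b , h , ps , t) → (t , Inverse.from (parity-↔ L) (h , b)) ∷ ps)
      (λ (b , h , ps , t) → cong (λ (h′ , b′) → b′ , h′ , ps , t) (Inverse.strictlyInverseˡ (parity-↔ L) (h , b)))
      (λ { ((t , β) ∷ ps) → cong (λ β′ → (t , β′) ∷ ps) (Inverse.strictlyInverseʳ (parity-↔ L) β) })

    FirstBlockEquation : ∀ {n} → ℤ → Fin 2 × Fin L × Vec Block n × Fin T → Set
    FirstBlockEquation w (b , h , ps , t) = toℤ t * (+ 2 * toℤ h + toℤ b) - alternating-sum ps ≡ w mod M

    first-block-equation-↔ : ∀ {n w} (ps : Vec Block (suc n)) →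
      (alternating-sum ps ≡ w mod M) ↔ FirstBlockEquation w (Inverse.to (first-block-↔ n) ps)
    first-block-equation-↔ ((t , β) ∷ ps) =
      ≡-mod-↔ (≡-mod-reflexive (cong (λ z → toℤ t * z - alternating-sum ps) (toℤ-to-parity-↔ L β))) ≡-mod-refl

    no-solution-of-length-0 : ∀ {w} → w ≡ + 1 mod 2 → Solutions 0 w ↔ Fin 0
    no-solution-of-length-0 {w} w≡1 =
      mk↔ₛ′ (λ { ([] , 0≡w) → ⊥-elim (0≢w 0≡w) }) (λ ()) (λ ()) (λ { ([] , 0≡w) → ⊥-elim (0≢w 0≡w) })
      where
      0≢w : ¬ (+ 0 ≡ w mod M)
      0≢w 0≡w = 0≢1-mod-2 (≡-mod-trans (≡-mod-∣ (ℕ.m∣m*n L) 0≡w) w≡1)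

    FirstBlockSolutions : ℕ → ℤ → Fin 2 → Set
    FirstBlockSolutions n w b =
      Σ (Fin L) λ h → Σ (Vec Block n) λ ps → Σ (Fin T) λ t → FirstBlockEquation w (b , h , ps , t)

    even-first-block-↔ : ∀ {n w} → w ≡ + 1 mod 2 →
      (∀ {w′} → w′ ≡ + 1 mod 2 → Solutions n w′ ↔ Fin (solution-count n)) →
      FirstBlockSolutions n w Fin.zero ↔ Fin (L ℕ.* (T ℕ.* solution-count n))
    even-first-block-↔ {n} {w} w≡1 solutions-↔ = begin
      FirstBlockSolutions n w Fin.zero
        ↔⟨ Σ-↔ ↔-refl (∃∃↔∃∃ _) ⟩
      (Σ (Fin L) λ h → Σ (Fin T) λ t → Σ (Vec Block n) λ ps → FirstBlockEquation w (Fin.zero , h , ps , t))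
        ↔⟨ Σ-↔ ↔-refl (λ {h} → Σ-↔ ↔-refl (λ {t} → Σ-↔ ↔-refl (a-l≡w↔l≡a-w {a = a h t}))) ⟩
      (Σ (Fin L) λ h → Σ (Fin T) λ t → Solutions n (a h t - w))
        ↔⟨ Σ-↔ ↔-refl (λ {h} → Σ-↔ ↔-refl (λ {t} → solutions-↔ (odd-target h t))) ⟩
      (Fin L × Fin T × Fin (solution-count n))
        ↔⟨ Fin-*³-↔ ⟨
      Fin (L ℕ.* (T ℕ.* solution-count n)) ∎
      where
      open EquationalReasoning
      a : Fin L → Fin T → ℤ
      a h t = toℤ t * (+ 2 * toℤ h + + 0)
      identity : ∀ t h → t * h * + 2 ≡ t * (+ 2 * h + + 0)
      identity = solve-∀
      odd-target : ∀ h t → a h t - w ≡ + 1 mod 2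
      odd-target h t = subst (λ z → z - w ≡ + 1 mod 2) (identity (toℤ t) (toℤ h)) (even-minus-odd (toℤ t * toℤ h) w≡1)

    odd-first-block-↔ : ∀ {n w} → FirstBlockSolutions n w (Fin.suc Fin.zero) ↔ Fin (L ℕ.* ((T ℕ.* M) ^ n ℕ.* d))
    odd-first-block-↔ {n} {w} = begin
      FirstBlockSolutions n w (Fin.suc Fin.zero)
        ↔⟨ Σ-↔ ↔-refl (λ {h} → Σ-↔ ↔-refl (↔-trans (Σ-↔ ↔-refl λ {t} → a-l≡w↔a≡w+l {a = toℤ t * u h})
                                              (unit-congruence-↔ d (*-odd-inverse (suc s) (2*x+1-odd (toℤ h)))))) ⟩
      (Fin L × Vec Block n × Fin d)
        ↔⟨ ↔-refl ×-↔ (Vec-↔-Fin^ n (↔-sym Fin.*↔×) ×-↔ ↔-refl) ⟩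
      (Fin L × Fin ((T ℕ.* M) ^ n) × Fin d)
        ↔⟨ Fin-*³-↔ ⟨
      Fin (L ℕ.* ((T ℕ.* M) ^ n ℕ.* d)) ∎
      where
      open EquationalReasoning
      u : Fin L → ℤ
      u h = + 2 * toℤ h + + 1

    solutions-↔ : ∀ n {w} → w ≡ + 1 mod 2 → Solutions n w ↔ Fin (solution-count n)
    solutions-↔ zero    w≡1 = no-solution-of-length-0 w≡1
    solutions-↔ (suc n) {w} w≡1 = begin
      Solutions (suc n) w
        ↔⟨ Σ-↔ (first-block-↔ n) (λ {ps} → first-block-equation-↔ ps) ⟩
      Σ (Fin 2 × Fin L × Vec Block n × Fin T) (FirstBlockEquation w)
        ↔⟨ Σ-assoc₄ ⟩
      Σ (Fin 2) (FirstBlockSolutions n w)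
        ↔⟨ Σ-Fin2-↔ ⟩
      (FirstBlockSolutions n w Fin.zero ⊎ FirstBlockSolutions n w (Fin.suc Fin.zero))
        ↔⟨ even-first-block-↔ w≡1 (solutions-↔ n) ⊎-↔ odd-first-block-↔ ⟩
      (Fin (L ℕ.* (T ℕ.* solution-count n)) ⊎ Fin (L ℕ.* ((T ℕ.* M) ^ n ℕ.* d)))
        ↔⟨ Fin.+↔⊎ ⟨
      Fin (solution-count (suc n)) ∎
      where open EquationalReasoning

    solution-count-closed-form : ∀ n → 2 ℕ.* L ℕ.* solution-count n ℕ.+ (L ℕ.* T) ^ n ≡ (T ℕ.* M) ^ n
    solution-count-closed-form zero    = cong (ℕ._+ 1) (ℕ.*-zeroʳ (2 ℕ.* L))
    solution-count-closed-form (suc n) = begin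
      2 ℕ.* L ℕ.* (L ℕ.* (T ℕ.* g) ℕ.+ L ℕ.* (X ℕ.* d)) ℕ.+ L ℕ.* T ℕ.* Y
        ≡⟨ identity₁ L T d g X Y ⟩
      L ℕ.* T ℕ.* (2 ℕ.* L ℕ.* g ℕ.+ Y) ℕ.+ 2 ℕ.* L ℕ.* L ℕ.* d ℕ.* X
        ≡⟨ cong (λ z → L ℕ.* T ℕ.* z ℕ.+ 2 ℕ.* L ℕ.* L ℕ.* d ℕ.* X) (solution-count-closed-form n) ⟩
      L ℕ.* T ℕ.* X ℕ.+ 2 ℕ.* L ℕ.* L ℕ.* d ℕ.* X
        ≡⟨ identity₂ L d X ⟩
      T ℕ.* M ℕ.* X ∎
      where
      open ≡-Reasoning
      g = solution-count n
      X = (T ℕ.* M) ^ n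
      Y = (L ℕ.* T) ^ n
      identity₁ : ∀ L T d g X Y → 2 ℕ.* L ℕ.* (L ℕ.* (T ℕ.* g) ℕ.+ L ℕ.* (X ℕ.* d)) ℕ.+ L ℕ.* T ℕ.* Y
                                ≡ L ℕ.* T ℕ.* (2 ℕ.* L ℕ.* g ℕ.+ Y) ℕ.+ 2 ℕ.* L ℕ.* L ℕ.* d ℕ.* X
      identity₁ = ℕ-Solver.solve-∀
      identity₂ : ∀ L d X → L ℕ.* (d ℕ.* (2 ℕ.* L)) ℕ.* X ℕ.+ 2 ℕ.* L ℕ.* L ℕ.* d ℕ.* X
                          ≡ d ℕ.* (2 ℕ.* L) ℕ.* (2 ℕ.* L) ℕ.* X
      identity₂ = ℕ-Solver.solve-∀

  -- The graphs 𝓔ₙ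

  module _ {n : ℕ} .{{_ : NonZero n}} where

    IsEdge⇔unimodular : ∀ a b c d → IsEdge n (a , b) (c , d) ⇔ (+ a * + d - + b * + c ≡ + 1 mod n)
    IsEdge⇔unimodular a b c d = mk⇔
      (λ e → let mk≡mod n∣ = Equivalence.to (%≡%⇔≡-mod (a ℕ.* d) (b ℕ.* c ℕ.+ 1)) e in ∣⇒≡-mod difference n∣)
      (λ (mk≡mod n∣) → Equivalence.from (%≡%⇔≡-mod (a ℕ.* d) (b ℕ.* c ℕ.+ 1)) (∣⇒≡-mod (sym difference) n∣))
      where
      identity : ∀ a d b c → a * d - (b * c + + 1) ≡ a * d - b * c - + 1
      identity = solve-∀
      difference : + (a ℕ.* d) - + (b ℕ.* c ℕ.+ 1) ≡ + a * + d - + b * + c - + 1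
      difference = begin
        + (a ℕ.* d) - + (b ℕ.* c ℕ.+ 1)   ≡⟨ cong₂ _-_ (ℤ.pos-* a d)
                                                   (trans (ℤ.pos-+ (b ℕ.* c) 1) (cong (_+ + 1) (ℤ.pos-* b c))) ⟩
        + a * + d - (+ b * + c + + 1)     ≡⟨ identity (+ a) (+ d) (+ b) (+ c) ⟩
        + a * + d - + b * + c - + 1       ∎
        where open ≡-Reasoning

    unimodular⇒coprime : ∀ {x g} → x ≡ + 1 mod n → + g ∣ℤ x → g ℕ.∣ n → g ≡ 1
    unimodular⇒coprime {x} {g} (mk≡mod n∣x-1) g∣x g∣n =
      ℕ.∣1⇒≡1 (ℤ∣.∣⇒∣ᵤ (subst (+ g ∣ℤ_) (identity x) (ℤ∣.∣m∣n⇒∣m-n g∣x (ℤ∣.∣-trans (ℤ∣.∣ᵤ⇒∣ g∣n) n∣x-1))))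
      where
      identity : ∀ x → x - (x - + 1) ≡ + 1
      identity = solve-∀

    IsEdge⇒IsVertex : ∀ {a b c d} → a < n → b < n → c < n → d < n → IsEdge n (a , b) (c , d) →
                      IsVertex n (a , b) × IsVertex n (c , d)
    IsEdge⇒IsVertex {a} {b} {c} {d} a<n b<n c<n d<n e =
        (a<n , b<n , unimodular⇒coprime det≡1 (∣det-source (gcd[m,n]∣m (gcd a b) n)) (gcd[m,n]∣n (gcd a b) n))
      , (c<n , d<n , unimodular⇒coprime det≡1 (∣det-target (gcd[m,n]∣m (gcd c d) n)) (gcd[m,n]∣n (gcd c d) n))
      where
      det≡1 = Equivalence.to (IsEdge⇔unimodular a b c d) e
      ∣det-source : ∀ {g} → g ℕ.∣ gcd a b → + g ∣ℤ + a * + d - + b * + c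
      ∣det-source g∣ab = ℤ∣.∣m∣n⇒∣m-n (ℤ∣.∣m⇒∣m*n {m = + a} (+ d) (ℤ∣.∣ᵤ⇒∣ (ℕ.∣-trans g∣ab (gcd[m,n]∣m a b))))
                                       (ℤ∣.∣m⇒∣m*n {m = + b} (+ c) (ℤ∣.∣ᵤ⇒∣ (ℕ.∣-trans g∣ab (gcd[m,n]∣n a b))))
      ∣det-target : ∀ {g} → g ℕ.∣ gcd c d → + g ∣ℤ + a * + d - + b * + c
      ∣det-target g∣cd = ℤ∣.∣m∣n⇒∣m-n (ℤ∣.∣n⇒∣m*n (+ a) {n = + d} (ℤ∣.∣ᵤ⇒∣ (ℕ.∣-trans g∣cd (gcd[m,n]∣n c d))))
                                       (ℤ∣.∣n⇒∣m*n (+ b) {n = + c} (ℤ∣.∣ᵤ⇒∣ (ℕ.∣-trans g∣cd (gcd[m,n]∣m c d))))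

  IsVertex-irrelevant : ∀ n v → Irrelevant (IsVertex n v)
  IsVertex-irrelevant n v = ×-irrelevant ℕ.<-irrelevant (×-irrelevant ℕ.<-irrelevant ℕ.≡-irrelevant)

  IsPath-irrelevant : ∀ n .{{_ : NonZero n}} vs → Irrelevant (IsPath n vs)
  IsPath-irrelevant n []           = λ _ _ → refl
  IsPath-irrelevant n (v ∷ [])     = IsVertex-irrelevant n v
  IsPath-irrelevant n (v ∷ w ∷ vs) =
    ×-irrelevant (IsVertex-irrelevant n v) (×-irrelevant ℕ.≡-irrelevant (IsPath-irrelevant n (w ∷ vs)))

  Pair-≡-irrelevant : ∀ {u v : Pair} → Irrelevant (u ≡ v)
  Pair-≡-irrelevant = UIP.Decidable⇒UIP.≡-irrelevant (×.≡-dec ℕ._≟_ (λ {_} → ℕ._≟_))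

  EvenAt-irrelevant : ∀ u e vs → Irrelevant (EvenAt u e vs)
  EvenAt-irrelevant u _     []       = λ _ _ → refl
  EvenAt-irrelevant u true  (v ∷ vs) = ×-irrelevant Pair-≡-irrelevant (EvenAt-irrelevant u false vs)
  EvenAt-irrelevant u false (v ∷ vs) = EvenAt-irrelevant u true vs

  Maybe-Pair-≡-irrelevant : ∀ {u v : Maybe Pair} → Irrelevant (u ≡ v)
  Maybe-Pair-≡-irrelevant = UIP.Decidable⇒UIP.≡-irrelevant (Maybe.≡-dec (×.≡-dec ℕ._≟_ (λ {_} → ℕ._≟_)))

  IsW-irrelevant : ∀ k r w → Irrelevant (IsW k r w)
  IsW-irrelevant k r w = ×-irrelevant (IsPath-irrelevant (2 ^ r) {{ℕ.m^n≢0 2 r}} _)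
    (×-irrelevant (×-irrelevant (IsPath-irrelevant 2 _) (EvenAt-irrelevant (1 , 0) true (toList (Vec.map reduce₂ w))))
                  (×-irrelevant Maybe-Pair-≡-irrelevant Maybe-Pair-≡-irrelevant))

  IsPath-head : ∀ {n} .{{_ : NonZero n}} {v} vs → IsPath n (v ∷ vs) → IsVertex n v
  IsPath-head []      v-vertex      = v-vertex
  IsPath-head (_ ∷ _) (v-vertex , _) = v-vertex

  IsPath-tail : ∀ {n} .{{_ : NonZero n}} {v} vs → IsPath n (v ∷ vs) → IsPath n vs
  IsPath-tail []      _            = tt
  IsPath-tail (_ ∷ _) (_ , _ , p)  = p

  private
    odd-of-coprime : ∀ x → x < 2 → gcd (gcd x 0) 2 ≡ 1 → x ≡ 1
    odd-of-coprime 0 _ ()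
    odd-of-coprime 1 _ _ = refl
    odd-of-coprime (suc (suc _)) (ℕ.s≤s (ℕ.s≤s ())) _

  -- Lifts to 𝓔_N as walks in ℤ/N

  module Walks (s : ℕ) where

    open Counting s 2 public

    N : ℕ
    N = T

    instance
      N≢0 : NonZero N
      N≢0 = ℕ.m*n≢0 2 M

    Vertex : Set
    Vertex = Fin N × Fin N

    num den : Vertex → ℤ
    num v = toℤ (proj₁ v)
    den v = toℤ (proj₂ v)

    det : Vertex → Vertex → ℤ
    det u v = num u * den v - den u * num v

    cramer : ∀ q x y → (det q x * num y ≡ det q y * num x - det x y * num q)
                     × (det q x * den y ≡ det q y * den x - det x y * den q)
    cramer q x y = identity₁ (num q) (den q) (num x) (den x) (num y) (den y)
                 , identity₂ (num q) (den q) (num x) (den x) (num y) (den y)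
      where
      identity₁ : ∀ a b c d e f → (a * d - b * c) * e ≡ (a * f - b * e) * c - (c * f - d * e) * a
      identity₁ = solve-∀
      identity₂ : ∀ a b c d e f → (a * d - b * c) * f ≡ (a * f - b * e) * d - (c * f - d * e) * b
      identity₂ = solve-∀

    unimodular-cramer : ∀ {q x y} → det q x ≡ + 1 mod N → det x y ≡ + 1 mod N →
                        (num y ≡ det q y * num x - num q mod N) × (den y ≡ det q y * den x - den q mod N)
    unimodular-cramer {q} {x} {y} qx≡1 xy≡1 = solve (num y) (num x) (num q) (proj₁ (cramer q x y))
                                            , solve (den y) (den x) (den q) (proj₂ (cramer q x y))
      where
      open ≡-mod-Reasoning N
      solve : ∀ zy zx zq → det q x * zy ≡ det q y * zx - det x y * zq → zy ≡ det q y * zx - zq mod N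
      solve zy zx zq eq = begin
        zy                            ≡⟨ ℤ.*-identityˡ zy ⟨
        + 1 * zy                      ≈⟨ *-cong-mod qx≡1 (≡-mod-refl {x = zy}) ⟨
        det q x * zy                  ≡⟨ eq ⟩
        det q y * zx - det x y * zq   ≈⟨ -‿cong-mod (≡-mod-refl {x = det q y * zx})
                                                    (*-cong-mod xy≡1 (≡-mod-refl {x = zq})) ⟩
        det q y * zx - + 1 * zq       ≡⟨ cong (λ z → det q y * zx - z) (ℤ.*-identityˡ zq) ⟩
        det q y * zx - zq             ∎

    twice : Fin M → Fin N
    twice β = Inverse.from (parity-↔ M) (β , Fin.zero)

    half : Fin N → Fin M
    half b = proj₁ (Inverse.to (parity-↔ M) b)

    toℤ-twice : ∀ β → toℤ (twice β) ≡ + 2 * toℤ β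
    toℤ-twice β = trans (toℤ-from-parity-↔ M β Fin.zero) (ℤ.+-identityʳ (+ 2 * toℤ β))

    half-twice : ∀ β → half (twice β) ≡ β
    half-twice β = cong proj₁ (Inverse.strictlyInverseˡ (parity-↔ M) (β , Fin.zero))

    twice-half : ∀ b → toℤ b ≡ + 0 mod 2 → twice (half b) ≡ b
    twice-half b b≡0 = trans (cong (λ bit → Inverse.from (parity-↔ M) (half b , bit)) (sym low-bit≡0))
                              (Inverse.strictlyInverseʳ (parity-↔ M) b)
      where
      open ≡-mod-Reasoning 2
      h = half b
      bit = proj₂ (Inverse.to (parity-↔ M) b)
      identity : ∀ h i → i ≡ (+ 2 * h + i) - + 2 * h
      identity = solve-∀
      low-bit≡0 : bit ≡ Fin.zero
      low-bit≡0 = toℤ-injective-mod (begin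
        toℤ bit                           ≡⟨ identity (toℤ h) (toℤ bit) ⟩
        (+ 2 * toℤ h + toℤ bit) - + 2 * toℤ h ≡⟨ cong (_- + 2 * toℤ h) (toℤ-to-parity-↔ M b) ⟨
        toℤ b - + 2 * toℤ h               ≈⟨ -‿cong-mod b≡0 (2*x-even (toℤ h)) ⟩
        + 0 - + 0                         ≡⟨⟩
        + 0                               ∎)

    den⁻¹ : Vertex → ℤ
    den⁻¹ q = odd-inverse (suc (suc s)) (den q)

    -- for odd den q, the unique vertex x with den x = b and det q x ≡ 1
    vertex-after : Vertex → Fin N → Vertex
    vertex-after q b = residue ((num q * toℤ b - + 1) * den⁻¹ q) , b

    det-vertex-after : ∀ {q} b → den q ≡ + 1 mod 2 → det q (vertex-after q b) ≡ + 1 mod N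
    det-vertex-after {q} b q-odd = begin
      num q * toℤ b - den q * num x                    ≈⟨ -‿cong-mod (≡-mod-refl {x = num q * toℤ b})
                                                            (*-cong-mod (≡-mod-refl {x = den q}) (toℤ-residue _)) ⟩
      num q * toℤ b - den q * ((num q * toℤ b - + 1) * den⁻¹ q) ≡⟨ identity₁ (num q * toℤ b) (den q) (den⁻¹ q) ⟩
      num q * toℤ b - den q * den⁻¹ q * (num q * toℤ b - + 1)   ≈⟨ -‿cong-mod (≡-mod-refl {x = num q * toℤ b})
                                                            (*-cong-mod (*-odd-inverse (suc (suc s)) q-odd)
                                                                        (≡-mod-refl {x = num q * toℤ b - + 1})) ⟩
      num q * toℤ b - + 1 * (num q * toℤ b - + 1)       ≡⟨ identity₂ (num q * toℤ b) ⟩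
      + 1                                              ∎
      where
      open ≡-mod-Reasoning N
      x = vertex-after q b
      identity₁ : ∀ a d i → a - d * ((a - + 1) * i) ≡ a - d * i * (a - + 1)
      identity₁ = solve-∀
      identity₂ : ∀ a → a - + 1 * (a - + 1) ≡ + 1
      identity₂ = solve-∀

    vertex-after-unique : ∀ {q x} → den q ≡ + 1 mod 2 → det q x ≡ + 1 mod N → vertex-after q (proj₂ x) ≡ x
    vertex-after-unique {q} {x} q-odd qx≡1 = cong (_, proj₂ x) (residue-unique (proj₁ x) (begin
      num x                                  ≡⟨ ℤ.*-identityˡ (num x) ⟨
      + 1 * num x                            ≈⟨ *-cong-mod (*-odd-inverse (suc (suc s)) q-odd)
                                                           (≡-mod-refl {x = num x}) ⟨
      den q * den⁻¹ q * num x                ≡⟨ identity (num q) (den q) (num x) (den x) (den⁻¹ q) ⟩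
      (num q * den x - det q x) * den⁻¹ q    ≈⟨ *-cong-mod (-‿cong-mod (≡-mod-refl {x = num q * den x}) qx≡1)
                                                           (≡-mod-refl {x = den⁻¹ q}) ⟩
      (num q * den x - + 1) * den⁻¹ q        ∎))
      where
      open ≡-mod-Reasoning N
      identity : ∀ a b c d i → b * i * c ≡ (a * d - (a * d - b * c)) * i
      identity = solve-∀

    next-vertex : Vertex → Vertex → Fin N → Vertex
    next-vertex q x t = residue (toℤ t * num x - num q) , residue (toℤ t * den x - den q)

    det-residue : ∀ u a b → det u (residue a , residue b) ≡ num u * b - den u * a mod N
    det-residue u a b = -‿cong-mod (*-cong-mod (≡-mod-refl {x = num u}) (toℤ-residue b))
                                   (*-cong-mod (≡-mod-refl {x = den u}) (toℤ-residue a))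

    det-x-next-vertex : ∀ q x t → det x (next-vertex q x t) ≡ det q x mod N
    det-x-next-vertex q x t = ≡-mod-trans (det-residue x _ _)
      (≡-mod-reflexive (identity (num q) (den q) (num x) (den x) (toℤ t)))
      where
      identity : ∀ a b c d t → c * (t * d - b) - d * (t * c - a) ≡ a * d - b * c
      identity = solve-∀

    det-q-next-vertex : ∀ q x t → det q (next-vertex q x t) ≡ toℤ t * det q x mod N
    det-q-next-vertex q x t = ≡-mod-trans (det-residue q _ _)
      (≡-mod-reflexive (identity (num q) (den q) (num x) (den x) (toℤ t)))
      where
      identity : ∀ a b c d t → a * (t * d - b) - b * (t * c - a) ≡ t * (a * d - b * c)
      identity = solve-∀

    next-vertex-unique : ∀ {q x y} → det q x ≡ + 1 mod N → det x y ≡ + 1 mod N →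
                        next-vertex q x (residue (det q y)) ≡ y
    next-vertex-unique {q} {x} {y} qx≡1 xy≡1 =
      cong₂ _,_ (residue-unique (proj₁ y) (≡-mod-trans num-y (-‿cong-mod (t≡ (num x)) (≡-mod-refl {x = num q}))))
                (residue-unique (proj₂ y) (≡-mod-trans den-y (-‿cong-mod (t≡ (den x)) (≡-mod-refl {x = den q}))))
      where
      num-y = proj₁ (unimodular-cramer {q} {x} {y} qx≡1 xy≡1)
      den-y = proj₂ (unimodular-cramer {q} {x} {y} qx≡1 xy≡1)
      t≡ : ∀ z → det q y * z ≡ toℤ (residue {N} (det q y)) * z mod N
      t≡ z = *-cong-mod (≡-mod-sym (toℤ-residue (det q y))) (≡-mod-refl {x = z})

    Step : Vertex → Vertex × Vertex → Set
    Step q (x , y) = det q x ≡ + 1 mod N × den x ≡ + 0 mod 2 × det x y ≡ + 1 mod N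

    Step-irrelevant : ∀ {q p} → Irrelevant (Step q p)
    Step-irrelevant = ×-irrelevant ≡-mod-irrelevant (×-irrelevant ≡-mod-irrelevant ≡-mod-irrelevant)

    step-↔ : ∀ {q} → den q ≡ + 1 mod 2 → Σ (Vertex × Vertex) (Step q) ↔ Block
    step-↔ {q} q-odd = mk↔ₛ′ block step
      (λ (t , β) → cong₂ _,_ (residue-unique t (≡-mod-sym (det-via t β))) (half-twice β))
      (λ (p , st) → Σ-≡-irrelevant (λ {p} → Step-irrelevant {q} {p}) (step-block p st))
      where
      open ≡-mod-Reasoning N
      block : Σ (Vertex × Vertex) (Step q) → Block
      block ((x , y) , _) = residue (det q y) , half (proj₂ x)
      det-after : ∀ β → det q (vertex-after q (twice β)) ≡ + 1 mod N
      det-after β = det-vertex-after {q} (twice β) q-odd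
      det-via : ∀ t β → det q (next-vertex q (vertex-after q (twice β)) t) ≡ toℤ t mod N
      det-via t β = begin
        det q (next-vertex q x t) ≈⟨ det-q-next-vertex q x t ⟩
        toℤ t * det q x          ≈⟨ *-cong-mod (≡-mod-refl {x = toℤ t}) (det-after β) ⟩
        toℤ t * + 1              ≡⟨ ℤ.*-identityʳ (toℤ t) ⟩
        toℤ t                    ∎
        where x = vertex-after q (twice β)
      step : Block → Σ (Vertex × Vertex) (Step q)
      step (t , β) = (x , next-vertex q x t) , det-after β
                   , subst (_≡ + 0 mod 2) (sym (toℤ-twice β)) (2*x-even (toℤ β))
                   , ≡-mod-trans (det-x-next-vertex q x t) (det-after β)
        where x = vertex-after q (twice β)
      step-block : ∀ p (st : Step q p) → proj₁ (step (block (p , st))) ≡ p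
      step-block (x , y) (qx≡1 , x-even , xy≡1) =
        cong₂ _,_ x≡ (trans (cong (λ x′ → next-vertex q x′ (residue (det q y))) x≡)
                            (next-vertex-unique {q} {x} {y} qx≡1 xy≡1))
        where
        x≡ : vertex-after q (twice (half (proj₂ x))) ≡ x
        x≡ = trans (cong (vertex-after q) (twice-half (proj₂ x) x-even)) (vertex-after-unique {q} {x} q-odd qx≡1)

    odd-after-even : ∀ {x y} → det x y ≡ + 1 mod N → den x ≡ + 0 mod 2 → den y ≡ + 1 mod 2
    odd-after-even {x} {y} xy≡1 x-even = odd-*ʳ (num x) (begin
      num x * den y               ≡⟨ identity (num x) (den x) (num y) (den y) ⟩
      det x y + den x * num y     ≈⟨ +-cong-mod (≡-mod-∣ (ℕ.m∣m*n M) xy≡1)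
                                                (*-cong-mod x-even (≡-mod-refl {x = num y})) ⟩
      + 1                         ∎)
      where
      open ≡-mod-Reasoning 2
      identity : ∀ a b c d → a * d ≡ (a * d - b * c) + b * c
      identity = solve-∀

    -- den of the last odd vertex of a tail with blocks ps after an odd vertex of den σ
    den-after : ∀ {m} → ℤ → Vec Block m → ℤ
    den-after σ []             = σ
    den-after σ ((t , β) ∷ ps) = den-after (toℤ t * (+ 2 * toℤ β) - σ) ps

    den-after-cong : ∀ {m σ σ′} (ps : Vec Block m) → σ ≡ σ′ mod N → den-after σ ps ≡ den-after σ′ ps mod N
    den-after-cong []             σ≡σ′ = σ≡σ′
    den-after-cong ((t , β) ∷ ps) σ≡σ′ =
      den-after-cong ps (-‿cong-mod (≡-mod-refl {x = toℤ t * (+ 2 * toℤ β)}) σ≡σ′)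

    den-after-closed-form : ∀ {m} σ (ps : Vec Block m) → den-after σ ps ≡ (- + 1) ℤ.^ m * (σ - + 2 * alternating-sum ps)
    den-after-closed-form σ []             = identity σ
      where
      identity : ∀ σ → σ ≡ + 1 * (σ - + 2 * + 0)
      identity = solve-∀
    den-after-closed-form {suc m} σ ((t , β) ∷ ps) =
      trans (den-after-closed-form _ ps) (identity ((- + 1) ℤ.^ m) (toℤ t) (toℤ β) σ (alternating-sum ps))
      where
      identity : ∀ e t β σ a → e * ((t * (+ 2 * β) - σ) - + 2 * a) ≡ - + 1 * e * (σ - + 2 * (t * β - a))
      identity = solve-∀

    den-after-↔-alternating-sum : ∀ {n} → (- + 1) ℤ.^ n ≡ - + 1 → (ps : Vec Block n) →
      (den-after (+ 1) ps ≡ + 1 mod N) ↔ (alternating-sum ps ≡ + 1 mod M)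
    den-after-↔-alternating-sum sign ps = ⇔⇒↔ ≡-mod-irrelevant ≡-mod-irrelevant (mk⇔
      (λ d≡1 → *-cancel-mod-scale 2 (≡-mod-trans (≡-mod-reflexive (identity₁ a))
                 (+-cong-mod (≡-mod-trans (≡-mod-reflexive (sym d≡2a-1)) d≡1) (≡-mod-refl {x = + 1}))))
      (λ a≡1 → ≡-mod-trans (≡-mod-reflexive d≡2a-1)
                 (-‿cong-mod (*-cong-mod-scale 2 a≡1) (≡-mod-refl {x = + 1}))))
      where
      a = alternating-sum ps
      identity₁ : ∀ a → + 2 * a ≡ + 2 * a - + 1 + + 1
      identity₁ = solve-∀
      identity₂ : ∀ a → - + 1 * (+ 1 - + 2 * a) ≡ + 2 * a - + 1
      identity₂ = solve-∀
      d≡2a-1 : den-after (+ 1) ps ≡ + 2 * a - + 1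
      d≡2a-1 = trans (den-after-closed-form (+ 1) ps) (trans (cong (_* (+ 1 - + 2 * a)) sign) (identity₂ a))

    double : ℕ → ℕ
    double zero    = zero
    double (suc m) = suc (suc (double m))

    double≡2* : ∀ m → double m ≡ 2 ℕ.* m
    double≡2* zero    = refl
    double≡2* (suc m) = trans (cong (suc ∘ suc) (double≡2* m)) (sym (ℕ.*-suc 2 m))

    IsWalk : List Vertex → Set
    IsWalk []           = ⊤
    IsWalk (v ∷ [])     = ⊤
    IsWalk (v ∷ w ∷ vs) = det v w ≡ + 1 mod N × IsWalk (w ∷ vs)

    EvenDenAt : Bool → List Vertex → Set
    EvenDenAt _     []       = ⊤
    EvenDenAt true  (v ∷ vs) = den v ≡ + 0 mod 2 × EvenDenAt false vs
    EvenDenAt false (v ∷ vs) = EvenDenAt true vs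

    EndsAt-1/0 : List Vertex → Set
    EndsAt-1/0 vs = last (map asPair vs) ≡ just (N ∸ 1 , 0)

    IsWalk-irrelevant : ∀ vs → Irrelevant (IsWalk vs)
    IsWalk-irrelevant []           = λ _ _ → refl
    IsWalk-irrelevant (v ∷ [])     = λ _ _ → refl
    IsWalk-irrelevant (v ∷ w ∷ vs) = ×-irrelevant ≡-mod-irrelevant (IsWalk-irrelevant (w ∷ vs))

    EvenDenAt-irrelevant : ∀ e vs → Irrelevant (EvenDenAt e vs)
    EvenDenAt-irrelevant _     []       = λ _ _ → refl
    EvenDenAt-irrelevant true  (v ∷ vs) = ×-irrelevant ≡-mod-irrelevant (EvenDenAt-irrelevant false vs)
    EvenDenAt-irrelevant false (v ∷ vs) = EvenDenAt-irrelevant true vs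

    IsTail : List Vertex → Set
    IsTail vs = IsWalk vs × EvenDenAt false vs × EndsAt-1/0 vs

    IsTail-irrelevant : ∀ vs → Irrelevant (IsTail vs)
    IsTail-irrelevant vs =
      ×-irrelevant (IsWalk-irrelevant vs) (×-irrelevant (EvenDenAt-irrelevant false vs) Maybe-Pair-≡-irrelevant)

    -- the walks q, x₁, y₁, …, xₘ, yₘ, -1/0 with even den at the xᵢ and at -1/0
    Tail : Vertex → ℕ → Set
    Tail q m = Σ (Vec Vertex (suc (double m))) λ vs → IsTail (q ∷ toList vs)

    0<N : 0 ℕ.< N
    0<N = ℕ.>-nonZero⁻¹ N

    N∸1<N : N ∸ 1 ℕ.< N
    N∸1<N = ℕ.∸-monoʳ-< ℕ.z<s 0<N

    -1/0 : Vertex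
    -1/0 = Fin.fromℕ< N∸1<N , Fin.fromℕ< 0<N

    den--1/0 : den -1/0 ≡ + 0
    den--1/0 = cong +_ (Fin.toℕ-fromℕ< 0<N)

    num--1/0 : num -1/0 ≡ - + 1 mod N
    num--1/0 = ∣⇒≡-mod (begin
      + 1 * + N               ≡⟨ ℤ.*-identityˡ (+ N) ⟩
      + N                     ≡⟨ cong +_ (ℕ.m∸n+n≡m 0<N) ⟨
      + (N ∸ 1 ℕ.+ 1)         ≡⟨ ℤ.pos-+ (N ∸ 1) 1 ⟩
      + (N ∸ 1) - - + 1       ≡⟨ cong (λ a → + a - - + 1) (Fin.toℕ-fromℕ< N∸1<N) ⟨
      num -1/0 - - + 1        ∎) (divides (+ 1) refl)
      where open ≡-Reasoning

    det-with--1/0 : ∀ q → det q -1/0 ≡ den q mod N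
    det-with--1/0 q = begin
      num q * den -1/0 - den q * num -1/0 ≈⟨ -‿cong-mod (≡-mod-reflexive (cong (num q *_) den--1/0))
                                                        (*-cong-mod (≡-mod-refl {x = den q}) num--1/0) ⟩
      num q * + 0 - den q * - + 1         ≡⟨ identity (num q) (den q) ⟩
      den q                               ∎
      where
      open ≡-mod-Reasoning N
      identity : ∀ a b → a * + 0 - b * - + 1 ≡ b
      identity = solve-∀

    ends-at--1/0 : ∀ {v} → just (asPair v) ≡ just (N ∸ 1 , 0) → v ≡ -1/0
    ends-at--1/0 end =
      cong₂ _,_ (Fin.toℕ-injective (trans (cong proj₁ (Maybe.just-injective end)) (sym (Fin.toℕ-fromℕ< N∸1<N))))
                (Fin.toℕ-injective (trans (cong proj₂ (Maybe.just-injective end)) (sym (Fin.toℕ-fromℕ< 0<N))))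

    tail-step-↔ : ∀ {q m} → Tail q (suc m) ↔ Σ (Σ (Vertex × Vertex) (Step q)) (λ ((x , y) , _) → Tail y m)
    tail-step-↔ = mk↔ₛ′
      (λ { ((x ∷ y ∷ vs) , (qx≡1 , xy≡1 , walk) , (x-even , even) , end) →
           ((x , y) , qx≡1 , x-even , xy≡1) , vs , walk , even , end })
      (λ (((x , y) , qx≡1 , x-even , xy≡1) , vs , walk , even , end) →
           (x ∷ y ∷ vs) , (qx≡1 , xy≡1 , walk) , (x-even , even) , end)
      (λ _ → refl)
      (λ { ((x ∷ y ∷ vs) , _) → refl })

    den-step : ∀ {q x y} → Step q (x , y) →
               den y ≡ toℤ (residue {N} (det q y)) * (+ 2 * toℤ (half (proj₂ x))) - den q mod N
    den-step {q} {x} {y} (qx≡1 , x-even , xy≡1) = begin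
      den y                          ≈⟨ proj₂ (unimodular-cramer {q} {x} {y} qx≡1 xy≡1) ⟩
      det q y * den x - den q        ≈⟨ -‿cong-mod (*-cong-mod (≡-mod-sym (toℤ-residue (det q y)))
                                                               (≡-mod-refl {x = den x}))
                                                   (≡-mod-refl {x = den q}) ⟩
      toℤ t * den x - den q          ≡⟨ cong (λ b → toℤ t * toℤ b - den q) (twice-half (proj₂ x) x-even) ⟨
      toℤ t * toℤ (twice β) - den q  ≡⟨ cong (λ z → toℤ t * z - den q) (toℤ-twice β) ⟩
      toℤ t * (+ 2 * toℤ β) - den q  ∎
      where
      open ≡-mod-Reasoning N
      t = residue {N} (det q y)
      β = half (proj₂ x)

    tail-↔ : ∀ m {q} → den q ≡ + 1 mod 2 → Tail q m ↔ Σ (Vec Block m) (λ ps → den-after (den q) ps ≡ + 1 mod N)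
    tail-↔ zero {q} q-odd = mk↔ₛ′
      (λ { ((z ∷ []) , (qz≡1 , _) , _ , end) →
           [] , ≡-mod-trans (≡-mod-sym (det-with--1/0 q)) (subst (λ v → det q v ≡ + 1 mod N) (ends-at--1/0 end) qz≡1) })
      (λ { ([] , q≡1) → (-1/0 ∷ []) , (≡-mod-trans (det-with--1/0 q) q≡1 , tt)
                      , (≡-mod-reflexive den--1/0 , tt)
                      , cong just (cong₂ _,_ (Fin.toℕ-fromℕ< N∸1<N) (Fin.toℕ-fromℕ< 0<N)) })
      (λ { ([] , _) → cong ([] ,_) (≡-mod-irrelevant _ _) })
      (λ { ((z ∷ []) , _ , _ , end) → Σ-≡-irrelevant (λ {vs} → IsTail-irrelevant (q ∷ toList vs))
                                                      (cong (_∷ []) (sym (ends-at--1/0 end))) })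
    tail-↔ (suc m) {q} q-odd = begin
      Tail q (suc m)                                                     ↔⟨ tail-step-↔ ⟩
      Σ (Σ (Vertex × Vertex) (Step q)) (λ ((x , y) , _) → Tail y m)      ↔⟨ Σ-↔ (step-↔ {q} q-odd) (λ {p} → rest-↔ p) ⟩
      (Σ Block λ (t , β) → Σ (Vec Block m) λ ps → den-after (den q) ((t , β) ∷ ps) ≡ + 1 mod N) ↔⟨ ∷-Σ-↔ ⟩
      Σ (Vec Block (suc m)) (λ ps → den-after (den q) ps ≡ + 1 mod N)   ∎
      where
      open EquationalReasoning
      rest-↔ : ∀ (p : Σ (Vertex × Vertex) (Step q)) →
               let ((x , y) , _) = p; (t , β) = Inverse.to (step-↔ {q} q-odd) p in
               Tail y m ↔ Σ (Vec Block m) (λ ps → den-after (toℤ t * (+ 2 * toℤ β) - den q) ps ≡ + 1 mod N)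
      rest-↔ ((x , y) , step@(_ , x-even , xy≡1)) =
        ↔-trans (tail-↔ m (odd-after-even {x} {y} xy≡1 x-even))
                (Σ-↔ ↔-refl (λ {ps} → ≡-mod-↔ (den-after-cong ps (den-step {q} {x} {y} step)) ≡-mod-refl))

    IsEdge⇔det : ∀ v w → IsEdge N (asPair v) (asPair w) ⇔ (det v w ≡ + 1 mod N)
    IsEdge⇔det v w = IsEdge⇔unimodular (toℕ (proj₁ v)) (toℕ (proj₂ v)) (toℕ (proj₁ w)) (toℕ (proj₂ w))

    IsEdge⇒IsVertex-Fin : ∀ v w → IsEdge N (asPair v) (asPair w) → IsVertex N (asPair v) × IsVertex N (asPair w)
    IsEdge⇒IsVertex-Fin (a , b) (c , d) = IsEdge⇒IsVertex (Fin.toℕ<n a) (Fin.toℕ<n b) (Fin.toℕ<n c) (Fin.toℕ<n d)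

    IsEdge-reduce₂ : ∀ v w → det v w ≡ + 1 mod N → IsEdge 2 (reduce₂ v) (reduce₂ w)
    IsEdge-reduce₂ (a , b) (c , d) vw≡1 =
      Equivalence.from (IsEdge⇔unimodular (toℕ a ℕ.% 2) (toℕ b ℕ.% 2) (toℕ c ℕ.% 2) (toℕ d ℕ.% 2)) (begin
      + (toℕ a ℕ.% 2) * + (toℕ d ℕ.% 2) - + (toℕ b ℕ.% 2) * + (toℕ c ℕ.% 2)
        ≈⟨ -‿cong-mod (*-cong-mod (%ℕ≡-mod (toℤ a)) (%ℕ≡-mod (toℤ d))) (*-cong-mod (%ℕ≡-mod (toℤ b)) (%ℕ≡-mod (toℤ c))) ⟩
      det (a , b) (c , d)
        ≈⟨ ≡-mod-∣ (ℕ.m∣m*n M) vw≡1 ⟩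
      + 1 ∎)
      where open ≡-mod-Reasoning 2

    IsEdge-reduce₂⇒IsVertex : ∀ v w → det v w ≡ + 1 mod N → IsVertex 2 (reduce₂ v) × IsVertex 2 (reduce₂ w)
    IsEdge-reduce₂⇒IsVertex (a , b) (c , d) vw≡1 =
      IsEdge⇒IsVertex (m%n<n (toℕ a) 2) (m%n<n (toℕ b) 2) (m%n<n (toℕ c) 2) (m%n<n (toℕ d) 2)
                      (IsEdge-reduce₂ (a , b) (c , d) vw≡1)

    IsPath⇒IsWalk : ∀ v w vs → IsPath N (map asPair (v ∷ w ∷ vs)) → IsWalk (v ∷ w ∷ vs)
    IsPath⇒IsWalk v w []       (_ , vw , _) = Equivalence.to (IsEdge⇔det v w) vw , tt
    IsPath⇒IsWalk v w (u ∷ us) (_ , vw , p) = Equivalence.to (IsEdge⇔det v w) vw , IsPath⇒IsWalk w u us p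

    IsWalk⇒IsPath : ∀ v w vs → IsWalk (v ∷ w ∷ vs) → IsPath N (map asPair (v ∷ w ∷ vs))
    IsWalk⇒IsPath v w []       (vw≡1 , _)    = let vw = Equivalence.from (IsEdge⇔det v w) vw≡1 in
      proj₁ (IsEdge⇒IsVertex-Fin v w vw) , vw , proj₂ (IsEdge⇒IsVertex-Fin v w vw)
    IsWalk⇒IsPath v w (u ∷ us) (vw≡1 , walk) = let vw = Equivalence.from (IsEdge⇔det v w) vw≡1 in
      proj₁ (IsEdge⇒IsVertex-Fin v w vw) , vw , IsWalk⇒IsPath w u us walk

    IsWalk⇒IsPath₂ : ∀ v w vs → IsWalk (v ∷ w ∷ vs) → IsPath 2 (map reduce₂ (v ∷ w ∷ vs))
    IsWalk⇒IsPath₂ v w []       (vw≡1 , _)    =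
      proj₁ (IsEdge-reduce₂⇒IsVertex v w vw≡1) , IsEdge-reduce₂ v w vw≡1 , proj₂ (IsEdge-reduce₂⇒IsVertex v w vw≡1)
    IsWalk⇒IsPath₂ v w (u ∷ us) (vw≡1 , walk) =
      proj₁ (IsEdge-reduce₂⇒IsVertex v w vw≡1) , IsEdge-reduce₂ v w vw≡1 , IsWalk⇒IsPath₂ w u us walk

    reduce₂≡1/0⇔ : ∀ v → IsVertex 2 (reduce₂ v) → (reduce₂ v ≡ (1 , 0)) ⇔ (den v ≡ + 0 mod 2)
    reduce₂≡1/0⇔ (a , b) (a<2 , _ , coprime) = mk⇔
      (λ v≡1/0 → Equivalence.to (%≡%⇔≡-mod (toℕ b) 0) (cong proj₂ v≡1/0))
      (λ b≡0 → let b%2≡0 = Equivalence.from (%≡%⇔≡-mod (toℕ b) 0) b≡0 in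
        cong₂ _,_ (odd-of-coprime _ a<2 (subst (λ z → gcd (gcd (toℕ a ℕ.% 2) z) 2 ≡ 1) b%2≡0 coprime)) b%2≡0)

    EvenAt⇔EvenDenAt : ∀ e vs → IsPath 2 (map reduce₂ vs) → EvenAt (1 , 0) e (map reduce₂ vs) ⇔ EvenDenAt e vs
    EvenAt⇔EvenDenAt e     []       _ = mk⇔ (λ _ → tt) (λ _ → tt)
    EvenAt⇔EvenDenAt true  (v ∷ vs) p = mk⇔
      (λ (v≡1/0 , rest) → Equivalence.to (reduce₂≡1/0⇔ v (IsPath-head _ p)) v≡1/0
                        , Equivalence.to (EvenAt⇔EvenDenAt false vs (IsPath-tail _ p)) rest)
      (λ (v-even , rest) → Equivalence.from (reduce₂≡1/0⇔ v (IsPath-head _ p)) v-even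
                         , Equivalence.from (EvenAt⇔EvenDenAt false vs (IsPath-tail _ p)) rest)
    EvenAt⇔EvenDenAt false (v ∷ vs) p = EvenAt⇔EvenDenAt true vs (IsPath-tail _ p)

    -- IsW in terms of ℤ/N: at even positions only den matters, an odd num then being forced
    IsLift : List Vertex → Set
    IsLift vs = IsWalk vs × EvenDenAt true vs × head (map asPair vs) ≡ just (1 , 0) × EndsAt-1/0 vs

    IsLift-irrelevant : ∀ vs → Irrelevant (IsLift vs)
    IsLift-irrelevant vs = ×-irrelevant (IsWalk-irrelevant vs)
      (×-irrelevant (EvenDenAt-irrelevant true vs) (×-irrelevant Maybe-Pair-≡-irrelevant Maybe-Pair-≡-irrelevant))

    IsW⇔IsLift : ∀ n (w : Vec Vertex (suc (2 ℕ.* suc n))) → IsW (suc n) (suc (suc s)) w ⇔ IsLift (toList w)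
    IsW⇔IsLift n w@(v ∷ u ∷ us) = mk⇔
      (λ (path , Ω , start , end) → let (path₂ , even) = reduced Ω in
         IsPath⇒IsWalk v u (toList us) path
         , Equivalence.to (EvenAt⇔EvenDenAt true (toList w) path₂) even
         , start , end)
      (λ (walk , even , start , end) → let path₂ = IsWalk⇒IsPath₂ v u (toList us) walk in
         IsWalk⇒IsPath v u (toList us) walk
         , subst (λ vs → IsPath 2 vs × EvenAt (1 , 0) true vs) (sym (Vec.toList-map reduce₂ w))
                 (path₂ , Equivalence.from (EvenAt⇔EvenDenAt true (toList w) path₂) even)
         , start , end)
      where
      reduced : InΩ (suc n) (Vec.map reduce₂ w) →
                IsPath 2 (map reduce₂ (toList w)) × EvenAt (1 , 0) true (map reduce₂ (toList w))
      reduced = subst (λ vs → IsPath 2 vs × EvenAt (1 , 0) true vs) (Vec.toList-map reduce₂ w)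

    W-↔-lifts : ∀ n → W (suc n) (suc (suc s)) ↔ Σ (Vec Vertex (suc (double (suc n)))) (IsLift ∘ toList)
    W-↔-lifts n = Σ-↔ (Vec-cast-↔ length≡) (λ {w} →
      ⇔⇒↔ (IsW-irrelevant (suc n) (suc (suc s)) w) (IsLift-irrelevant _)
          (subst (λ vs → IsW (suc n) (suc (suc s)) w ⇔ IsLift vs) (sym (Vec.toList-cast length≡ w)) (IsW⇔IsLift n w)))
      where
      length≡ : suc (2 ℕ.* suc n) ≡ suc (double (suc n))
      length≡ = cong suc (sym (double≡2* (suc n)))

    1<N : 1 ℕ.< N
    1<N = ℕ.m≤m*n 2 M

    one : Fin N
    one = Fin.fromℕ< 1<N

    toℤ-one : toℤ one ≡ + 1
    toℤ-one = cong +_ (Fin.toℕ-fromℕ< 1<N)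

    1/0 : Vertex
    1/0 = one , Fin.fromℕ< 0<N

    det-1/0 : ∀ v → det 1/0 v ≡ den v
    det-1/0 v = begin
      toℤ one * den v - toℤ (Fin.fromℕ< 0<N) * num v ≡⟨ cong₂ (λ a b → a * den v - b * num v)
                                                              toℤ-one (cong +_ (Fin.toℕ-fromℕ< 0<N)) ⟩
      + 1 * den v - + 0 * num v                       ≡⟨ identity (den v) (num v) ⟩
      den v                                           ∎
      where
      open ≡-Reasoning
      identity : ∀ b a → + 1 * b - + 0 * a ≡ b
      identity = solve-∀

    starts-at-1/0 : ∀ {v} → just (asPair v) ≡ just (1 , 0) → v ≡ 1/0
    starts-at-1/0 start =
      cong₂ _,_ (Fin.toℕ-injective (trans (cong proj₁ (Maybe.just-injective start)) (sym (Fin.toℕ-fromℕ< 1<N))))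
                (Fin.toℕ-injective (trans (cong proj₂ (Maybe.just-injective start)) (sym (Fin.toℕ-fromℕ< 0<N))))

    after-1/0 : ∀ {v w} → just (asPair v) ≡ just (1 , 0) → det v w ≡ + 1 mod N → w ≡ (proj₁ w , one)
    after-1/0 {v} {w} start vw≡1 = cong (proj₁ w ,_) (toℤ-injective-mod
      (≡-mod-trans (≡-mod-reflexive (trans (sym (det-1/0 w)) (cong (λ u → det u w) (sym (starts-at-1/0 start)))))
                   (≡-mod-trans vw≡1 (≡-mod-reflexive (sym toℤ-one)))))

    lifts-↔-tails : ∀ n → Σ (Vec Vertex (suc (double (suc n)))) (IsLift ∘ toList) ↔ Σ (Fin N) (λ c → Tail (c , one) n)
    lifts-↔-tails n = mk↔ₛ′
      (λ { ((v ∷ w ∷ vs) , (vw≡1 , walk) , (_ , even) , start , end) →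
           proj₁ w , vs , subst (λ u → IsTail (u ∷ toList vs)) (after-1/0 start vw≡1) (walk , even , end) })
      (λ (c , vs , walk , even , end) →
           (1/0 ∷ (c , one) ∷ vs) , (≡-mod-reflexive (trans (det-1/0 (c , one)) toℤ-one) , walk)
           , (≡-mod-reflexive (cong +_ (Fin.toℕ-fromℕ< 0<N)) , even)
           , cong just (cong₂ _,_ (Fin.toℕ-fromℕ< 1<N) (Fin.toℕ-fromℕ< 0<N)) , end)
      (λ (c , vs , _) → cong (c ,_) (Σ-≡-irrelevant (λ {us} → IsTail-irrelevant ((c , one) ∷ toList us)) refl))
      (λ { ((v ∷ w ∷ vs) , (vw≡1 , _) , _ , start , _) →
           Σ-≡-irrelevant (λ {us} → IsLift-irrelevant (toList us))
                          (cong₂ _∷_ (sym (starts-at-1/0 start)) (cong (_∷ vs) (sym (after-1/0 start vw≡1)))) })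

    tail-from-c/1-↔ : ∀ n c → Tail (c , one) n ↔ Σ (Vec Block n) (λ ps → den-after (+ 1) ps ≡ + 1 mod N)
    tail-from-c/1-↔ n c = ↔-trans (tail-↔ n (≡-mod-reflexive toℤ-one))
      (Σ-↔ ↔-refl (λ {ps} → ≡-mod-↔ (den-after-cong ps (≡-mod-reflexive toℤ-one)) ≡-mod-refl))

    W-↔-Fin : ∀ n → 2 ℕ.∣ suc n → W (suc n) (suc (suc s)) ↔ Fin (N ℕ.* solution-count n)
    W-↔-Fin n 2∣1+n = begin
      W (suc n) (suc (suc s))
        ↔⟨ W-↔-lifts n ⟩
      Σ (Vec Vertex (suc (double (suc n)))) (IsLift ∘ toList)
        ↔⟨ lifts-↔-tails n ⟩
      Σ (Fin N) (λ c → Tail (c , one) n)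
        ↔⟨ Σ-↔ ↔-refl (λ {c} → tail-from-c/1-↔ n c) ⟩
      (Fin N × Σ (Vec Block n) (λ ps → den-after (+ 1) ps ≡ + 1 mod N))
        ↔⟨ ↔-refl ×-↔ Σ-↔ ↔-refl (λ {ps} → den-after-↔-alternating-sum (-1^-odd n 2∣1+n) ps) ⟩
      (Fin N × Solutions n (+ 1))
        ↔⟨ ↔-refl ×-↔ solutions-↔ n ≡-mod-refl ⟩
      (Fin N × Fin (solution-count n))
        ↔⟨ Fin.*↔× ⟨
      Fin (N ℕ.* solution-count n) ∎
      where open EquationalReasoning

open import Defs
open import Data.Nat using (ℕ; zero; suc; _+_; _*_; _^_; _∸_; _<_; _>_; s≤s)
import Data.Nat.Properties as ℕ
open import Data.Nat.Divisibility using (_∣_)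
open import Data.Nat.Tactic.RingSolver using (solve-∀)
open import Data.Fin using (Fin)
open import Function.Bundles using (_↔_)
open import Function.Properties.Inverse using (↔-sym; ↔-trans)
open import Function.Related.Propositional using (K-reflexive; bijection)
open import Relation.Binary.PropositionalEquality
open Lifts using (module Walks)

*-^-distrib : ∀ a b n → (a * b) ^ n ≡ a ^ n * b ^ n
*-^-distrib a b zero    = refl
*-^-distrib a b (suc n) = trans (cong (a * b *_) (*-^-distrib a b n)) (identity a b (a ^ n) (b ^ n))
  where
  identity : ∀ a b x y → a * b * (x * y) ≡ a * x * (b * y)
  identity = solve-∀

module Cardinality (s n : ℕ) where

  open Walks s using (L; M; N; solution-count; solution-count-closed-form)

  P : ℕ
  P = L * N

  lift-count : N * solution-count n ≡ 2 * P ^ n * (2 ^ n ∸ 1)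
  lift-count = begin
    N * g                           ≡⟨ identity₁ L g ⟩
    2 * (2 * L * g)                 ≡⟨ cong (2 *_) (ℕ.m+n∸n≡m (2 * L * g) (P ^ n)) ⟨
    2 * (2 * L * g + P ^ n ∸ P ^ n) ≡⟨ cong (λ z → 2 * (z ∸ P ^ n)) (solution-count-closed-form n) ⟩
    2 * ((N * M) ^ n ∸ P ^ n)       ≡⟨ cong (λ z → 2 * (z ^ n ∸ P ^ n)) (identity₂ L) ⟩
    2 * ((2 * P) ^ n ∸ P ^ n)       ≡⟨ cong (λ z → 2 * (z ∸ P ^ n)) (*-^-distrib 2 P n) ⟩
    2 * (2 ^ n * P ^ n ∸ P ^ n)     ≡⟨ cong (λ z → 2 * (2 ^ n * P ^ n ∸ z)) (ℕ.*-identityˡ (P ^ n)) ⟨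
    2 * (2 ^ n * P ^ n ∸ 1 * P ^ n) ≡⟨ cong (2 *_) (ℕ.*-distribʳ-∸ (P ^ n) (2 ^ n) 1) ⟨
    2 * ((2 ^ n ∸ 1) * P ^ n)       ≡⟨ identity₃ (2 ^ n ∸ 1) (P ^ n) ⟩
    2 * P ^ n * (2 ^ n ∸ 1)         ∎
    where
    open ≡-Reasoning
    g = solution-count n
    identity₁ : ∀ L g → 2 * (2 * L) * g ≡ 2 * (2 * L * g)
    identity₁ = solve-∀
    identity₂ : ∀ L → 2 * (2 * L) * (2 * L) ≡ 2 * (L * (2 * (2 * L)))
    identity₂ = solve-∀
    identity₃ : ∀ x y → 2 * (x * y) ≡ 2 * y * x
    identity₃ = solve-∀

  formula-count : 2 ^ ((suc (suc s) ∸ 2) * (2 * suc n ∸ 2)) * 2 ^ (2 * suc n ∸ 1) * (2 ^ (suc n ∸ 1) ∸ 1)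
                ≡ 2 * P ^ n * (2 ^ n ∸ 1)
  formula-count = begin
    2 ^ (s * (2 * suc n ∸ 2)) * 2 ^ (2 * suc n ∸ 1) * (2 ^ n ∸ 1)
      ≡⟨ cong (λ m → 2 ^ (s * (m ∸ 2)) * 2 ^ (m ∸ 1) * (2 ^ n ∸ 1)) (ℕ.*-suc 2 n) ⟩
    2 ^ (s * (2 * n)) * (2 * 2 ^ (2 * n)) * (2 ^ n ∸ 1)
      ≡⟨ cong (_* (2 ^ n ∸ 1)) (identity₁ (2 ^ (s * (2 * n))) (2 ^ (2 * n))) ⟩
    2 * (2 ^ (s * (2 * n)) * 2 ^ (2 * n)) * (2 ^ n ∸ 1)
      ≡⟨ cong (λ z → 2 * z * (2 ^ n ∸ 1)) (ℕ.^-distribˡ-+-* 2 (s * (2 * n)) (2 * n)) ⟨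
    2 * 2 ^ (s * (2 * n) + 2 * n) * (2 ^ n ∸ 1)
      ≡⟨ cong (λ z → 2 * 2 ^ z * (2 ^ n ∸ 1)) (identity₂ s n) ⟩
    2 * 2 ^ ((s + suc (suc s)) * n) * (2 ^ n ∸ 1)
      ≡⟨ cong (λ z → 2 * z * (2 ^ n ∸ 1)) (ℕ.^-*-assoc 2 (s + suc (suc s)) n) ⟨
    2 * (2 ^ (s + suc (suc s))) ^ n * (2 ^ n ∸ 1)
      ≡⟨ cong (λ z → 2 * z ^ n * (2 ^ n ∸ 1)) (ℕ.^-distribˡ-+-* 2 s (suc (suc s))) ⟩
    2 * P ^ n * (2 ^ n ∸ 1)
      ∎
    where
    open ≡-Reasoning
    identity₁ : ∀ a b → a * (2 * b) ≡ 2 * (a * b)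
    identity₁ = solve-∀
    identity₂ : ∀ s n → s * (2 * n) + 2 * n ≡ (s + (2 + s)) * n
    identity₂ = solve-∀

lemma10 : (k r : ℕ) → k > 0 → 2 ∣ k → 1 < r →
          Fin (2 ^ ((r ∸ 2) * (2 * k ∸ 2)) * 2 ^ (2 * k ∸ 1) * (2 ^ (k ∸ 1) ∸ 1)) ↔ W k r
lemma10 (suc n) (suc zero)    _ _   (s≤s ())
lemma10 (suc n) (suc (suc s)) _ 2∣k _ =
  ↔-trans (K-reflexive {k = bijection} (cong Fin (trans formula-count (sym lift-count))))
          (↔-sym (W-↔-Fin n 2∣k))
  where
  open Cardinality s n
  open Walks s using (W-↔-Fin)
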